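{- Let $p$ be a prime, $k\ge1$ and $m\ge0$ integers, $C\in\mathcal{R}^{\mathsf{sh}}_p(m)$ and $D\in\mathcal{R}_p(k)$. Then there are unique polynomials $Q\in\mathbf{F}_p[T]$ and $$R\in T^{m-k+1}\mathcal{R}^{\mathsf{sh}}_p(k-1)\cap\mathbf{F}_p[T]$$ such that $C=QD+R$. Moreover, $T^{m-k+1}\mathcal{R}^{\mathsf{sh}}_p(k-1)\cap\mathbf{F}_p[T]\subset\mathcal{R}^{\mathsf{sh}}_p(m)$.
   Context: For $\ell\ge0$, $\mathcal{R}^{\mathsf{sh}}_p(\ell)$ is the $\mathbf{F}_p$-vector space of polynomials $c_\ell+c_{\ell-1}T+\dots+c_1T^{\ell-1}+c_0T^\ell+c_1T^{\ell+1}+\dots+c_\ell T^{2\ell}$ with $c_i\in\mathbf{F}_p$. $\mathcal{R}_p(k)$ is the set of such polynomials with $\ell=k$ and $c_k=1$, i.e. monic reciprocal polynomials of degree $2k$. The set $T^{j}\mathcal{R}^{\mathsf{sh}}_p(k-1)=\{T^jF:F\in\mathcal{R}^{\mathsf{sh}}_p(k-1)\}$ is a set of Laurent polynomials when $j<0$, and it is intersected with $\mathbf{F}_p[T]$. -}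

module Defs where

open import Data.Nat using (ℕ; zero; suc; _≤_; _<_; _∸_; NonZero) renaming (_+_ to _+ℕ_; _*_ to _*ℕ_)
open import Data.Nat.DivMod using (_mod_)
open import Data.Fin using (Fin; toℕ)
open import Data.Integer using (ℤ; +_; -[1+_]) renaming (_-_ to _-ℤ_)
open import Data.Product using (Σ; ∃; _×_)
open import Relation.Binary.PropositionalEquality using (_≡_)

module _ (p : ℕ) .{{_ : NonZero p}} where

  𝔽 : Set
  𝔽 = Fin p

  0F 1F : 𝔽
  0F = 0 mod p
  1F = 1 mod p

  _+F_ _*F_ : 𝔽 → 𝔽 → 𝔽
  a +F b = (toℕ a +ℕ toℕ b) mod p
  a *F b = (toℕ a *ℕ toℕ b) mod p

  -- Coefficient sequences: c i is the coefficient of T^i.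
  Coeffs : Set
  Coeffs = ℕ → 𝔽

  IsPoly : Coeffs → Set
  IsPoly c = ∃ λ d → ∀ i → d < i → c i ≡ 0F

  sumTo : (ℕ → 𝔽) → ℕ → 𝔽
  sumTo f zero    = f 0
  sumTo f (suc n) = sumTo f n +F f (suc n)

  _+P_ : Coeffs → Coeffs → Coeffs
  (f +P g) n = f n +F g n

  _*P_ : Coeffs → Coeffs → Coeffs
  (f *P g) n = sumTo (λ j → f j *F g (n ∸ j)) n

  InRsh : ℕ → Coeffs → Set
  InRsh ℓ c = (∀ i → 2 *ℕ ℓ < i → c i ≡ 0F)
            × (∀ i → i ≤ 2 *ℕ ℓ → c i ≡ c ((2 *ℕ ℓ) ∸ i))

  -- R_p(k): elements of R^sh_p(k) with c_k = 1, i.e. constant term 1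
  InR : ℕ → Coeffs → Set
  InR k c = InRsh k c × (c 0 ≡ 1F)

  -- Laurent coefficients of T^s F (s ∈ ℤ): coefficient at T^n is F (n - s)
  shiftCoeff : ℤ → Coeffs → ℤ → 𝔽
  shiftCoeff s F n with n -ℤ s
  ... | + j      = F j
  ... | -[1+ _ ] = 0F

  InShiftRsh : ℤ → ℕ → Coeffs → Set
  InShiftRsh s ℓ R = Σ Coeffs λ F → InRsh ℓ F
                     × (∀ n → shiftCoeff s F (-[1+ n ]) ≡ 0F)
                     × (∀ n → R n ≡ shiftCoeff s F (+ n))

-- The admissible remainders T^(m−k+1) R^sh_p(k−1) ∩ F_p[T] are exactly the elements of R^sh_p(m)
-- vanishing in degrees ≤ m − k; both descriptions are palindromy conditions z ↦ c − z on the
-- coefficients extended by zero to ℤ, and multiplying by T^s moves the centre c by 2s.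
-- Existence is by induction on m. For m < k, C is its own remainder. Otherwise
-- S = D + T^(2(m−k)) D (just D when m = k) lies in R_p(m), so C − C(0) S ∈ R^sh_p(m) has zero
-- constant term, hence zero top coefficient, and is T times an element of R^sh_p(m−1).
-- Uniqueness: (Q − Q′) D = R′ − R vanishes in degrees ≤ m − k and ≥ m + k. Since D has constant
-- and leading coefficient 1, induction upwards from degree 0 shows that Q − Q′ vanishes in degrees
-- ≤ m − k, and induction downwards from its degree shows that it vanishes in degrees ≥ m − k.
module Submission where

open import Defs hiding (_+F_; _*F_; 0F; 1F)
import Defs
open import Algebra.Bundles using (CommutativeRing)
open import Algebra.Definitions using (Associative)
open import Algebra.Consequences.Propositional
  using (comm∧idˡ⇒id; comm∧invˡ⇒inv; comm∧distrʳ⇒distrˡ)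
import Algebra.Properties.Ring as RingProperties
import Algebra.Properties.Group as GroupProperties
import Algebra.Properties.CommutativeSemigroup as CommutativeSemigroupProperties
open import Level using (0ℓ)
open import Data.Nat
  using (ℕ; zero; suc; _+_; _*_; _∸_; _≤_; _<_; z≤n; s≤s; _≤?_; _<?_; _≟_; _⊔_; _%_; NonZero; >-nonZero⁻¹)
import Data.Nat.Properties as ℕ
import Data.Nat.Tactic.RingSolver as ℕ-Solver
open import Data.Nat.DivMod using (_mod_; %-distribˡ-+; %-distribˡ-*; n%n≡0; m<n⇒m%n≡m; m%n<n)
open import Data.Nat.Primality using (Prime)
open import Data.Fin using (toℕ)
open import Data.Fin.Properties using (toℕ-injective; toℕ-fromℕ<; toℕ<n)
open import Data.Integer using (ℤ; +_; -[1+_]; _⊖_)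
  renaming (_+_ to _+ℤ_; _-_ to _-ℤ_; _*_ to _*ℤ_; -_ to negate)
import Data.Integer.Properties as ℤ
open import Data.Integer.Tactic.RingSolver using (solve-∀)
open import Data.Product using (Σ; _×_; _,_; proj₁; proj₂)
open import Data.Sum using (inj₁; inj₂)
open import Data.Empty using (⊥-elim)
open import Function using (_∘_; _⇔_; mk⇔; Equivalence)
open import Relation.Nullary using (yes; no)
open import Relation.Binary.Definitions using (tri<; tri≈; tri>)
open import Relation.Binary.PropositionalEquality
  using (_≡_; _≢_; refl; sym; trans; cong; cong₂; subst; isEquivalence; module ≡-Reasoning)
open ≡-Reasoning
open Equivalence using (to; from)

-- Every ring law of 𝔽 p is inherited from ℕ along the surjective homomorphism [_] = _mod p.
module _ (p : ℕ) .{{_ : NonZero p}} where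
  private
    _+F_ _*F_ : 𝔽 p → 𝔽 p → 𝔽 p
    _+F_ = Defs._+F_ p
    _*F_ = Defs._*F_ p

    -F_ : 𝔽 p → 𝔽 p
    -F x = (p ∸ toℕ x) mod p

    [_] : ℕ → 𝔽 p
    [ n ] = n mod p

    toℕ-[] : ∀ n → toℕ [ n ] ≡ n % p
    toℕ-[] n = toℕ-fromℕ< (m%n<n n p)

    []-toℕ : ∀ x → [ toℕ x ] ≡ x
    []-toℕ x = toℕ-injective (trans (toℕ-[] (toℕ x)) (m<n⇒m%n≡m (toℕ<n x)))

    []-cong-% : ∀ {m n} → m % p ≡ n % p → [ m ] ≡ [ n ]
    []-cong-% {m} {n} eq = toℕ-injective (trans (toℕ-[] m) (trans eq (sym (toℕ-[] n))))

    []-+ : ∀ m n → [ m ] +F [ n ] ≡ [ m + n ]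
    []-+ m n = []-cong-% (begin
      (toℕ [ m ] + toℕ [ n ]) % p ≡⟨ cong₂ (λ a b → (a + b) % p) (toℕ-[] m) (toℕ-[] n) ⟩
      (m % p + n % p) % p         ≡⟨ %-distribˡ-+ m n p ⟨
      (m + n) % p                 ∎)

    []-* : ∀ m n → [ m ] *F [ n ] ≡ [ m * n ]
    []-* m n = []-cong-% (begin
      (toℕ [ m ] * toℕ [ n ]) % p ≡⟨ cong₂ (λ a b → (a * b) % p) (toℕ-[] m) (toℕ-[] n) ⟩
      (m % p * (n % p)) % p       ≡⟨ %-distribˡ-* m n p ⟨
      (m * n) % p                 ∎)

    lift-assoc : ∀ (_∙_ : 𝔽 p → 𝔽 p → 𝔽 p) (_⋆_ : ℕ → ℕ → ℕ) →
                 (∀ x y → x ∙ y ≡ [ toℕ x ⋆ toℕ y ]) →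
                 (∀ m n → [ m ] ∙ [ n ] ≡ [ m ⋆ n ]) →
                 Associative _≡_ _⋆_ → Associative _≡_ _∙_
    lift-assoc _∙_ _⋆_ def hom ⋆-assoc x y z = begin
      (x ∙ y) ∙ z         ≡⟨ cong₂ _∙_ (def x y) (sym ([]-toℕ z)) ⟩
      [ a ⋆ b ] ∙ [ c ]   ≡⟨ hom (a ⋆ b) c ⟩
      [ (a ⋆ b) ⋆ c ]     ≡⟨ cong [_] (⋆-assoc a b c) ⟩
      [ a ⋆ (b ⋆ c) ]     ≡⟨ hom a (b ⋆ c) ⟨
      [ a ] ∙ [ b ⋆ c ]   ≡⟨ cong₂ _∙_ ([]-toℕ x) (sym (def y z)) ⟩
      x ∙ (y ∙ z)         ∎
      where a = toℕ x ; b = toℕ y ; c = toℕ z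

    +F-comm : ∀ x y → x +F y ≡ y +F x
    +F-comm x y = cong [_] (ℕ.+-comm (toℕ x) (toℕ y))

    *F-comm : ∀ x y → x *F y ≡ y *F x
    *F-comm x y = cong [_] (ℕ.*-comm (toℕ x) (toℕ y))

    +F-identityˡ : ∀ x → [ 0 ] +F x ≡ x
    +F-identityˡ x = begin
      [ 0 ] +F x          ≡⟨ cong ([ 0 ] +F_) ([]-toℕ x) ⟨
      [ 0 ] +F [ toℕ x ]  ≡⟨ []-+ 0 (toℕ x) ⟩
      [ toℕ x ]           ≡⟨ []-toℕ x ⟩
      x                   ∎

    *F-identityˡ : ∀ x → [ 1 ] *F x ≡ x
    *F-identityˡ x = begin
      [ 1 ] *F x          ≡⟨ cong ([ 1 ] *F_) ([]-toℕ x) ⟨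
      [ 1 ] *F [ toℕ x ]  ≡⟨ []-* 1 (toℕ x) ⟩
      [ 1 * toℕ x ]       ≡⟨ cong [_] (ℕ.*-identityˡ (toℕ x)) ⟩
      [ toℕ x ]           ≡⟨ []-toℕ x ⟩
      x                   ∎

    -F-inverseˡ : ∀ x → (-F x) +F x ≡ [ 0 ]
    -F-inverseˡ x = begin
      (-F x) +F x         ≡⟨ cong ((-F x) +F_) ([]-toℕ x) ⟨
      [ p ∸ a ] +F [ a ]  ≡⟨ []-+ (p ∸ a) a ⟩
      [ p ∸ a + a ]       ≡⟨ cong [_] (ℕ.m∸n+n≡m (ℕ.<⇒≤ (toℕ<n x))) ⟩
      [ p ]               ≡⟨ []-cong-% (trans (n%n≡0 p) (sym (m<n⇒m%n≡m (>-nonZero⁻¹ p)))) ⟩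
      [ 0 ]               ∎
      where a = toℕ x

    *F-distribʳ : ∀ z x y → (x +F y) *F z ≡ (x *F z) +F (y *F z)
    *F-distribʳ z x y = begin
      [ a + b ] *F z        ≡⟨ cong ([ a + b ] *F_) ([]-toℕ z) ⟨
      [ a + b ] *F [ c ]    ≡⟨ []-* (a + b) c ⟩
      [ (a + b) * c ]       ≡⟨ cong [_] (ℕ.*-distribʳ-+ c a b) ⟩
      [ a * c + b * c ]     ≡⟨ []-+ (a * c) (b * c) ⟨
      (x *F z) +F (y *F z)  ∎
      where a = toℕ x ; b = toℕ y ; c = toℕ z

  𝔽-commutativeRing : CommutativeRing 0ℓ 0ℓ
  𝔽-commutativeRing = record
    { _+_ = _+F_ ; _*_ = _*F_ ; -_ = -F_ ; 0# = [ 0 ] ; 1# = [ 1 ]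
    ; isCommutativeRing = record
      { isRing = record
        { +-isAbelianGroup = record
          { isGroup = record
            { isMonoid = record
              { isSemigroup = record
                { isMagma = record { isEquivalence = isEquivalence ; ∙-cong = cong₂ _+F_ }
                ; assoc = lift-assoc _+F_ _+_ (λ _ _ → refl) []-+ ℕ.+-assoc }
              ; identity = comm∧idˡ⇒id +F-comm +F-identityˡ }
            ; inverse = comm∧invˡ⇒inv +F-comm -F-inverseˡ
            ; ⁻¹-cong = cong -F_ }
          ; comm = +F-comm }
        ; *-cong = cong₂ _*F_
        ; *-assoc = lift-assoc _*F_ _*_ (λ _ _ → refl) []-* ℕ.*-assoc
        ; *-identity = comm∧idˡ⇒id *F-comm *F-identityˡ
        ; distrib = comm∧distrʳ⇒distrˡ *F-comm *F-distribʳ , *F-distribʳ }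
      ; *-comm = *F-comm } }

remainderShift : ℕ → ℕ → ℤ
remainderShift m k = (+ m -ℤ + k) +ℤ + 1

Palindromic : {A : Set} → ℤ → (ℤ → A) → Set
Palindromic c F = ∀ z → F z ≡ F (c -ℤ z)

IsShift : {A : Set} → ℤ → (ℤ → A) → (ℤ → A) → Set
IsShift s G F = ∀ z → F z ≡ G (z -ℤ s)

palindromic-shift : ∀ {A : Set} {s c : ℤ} {G F : ℤ → A} →
                    IsShift s G F → Palindromic c G ⇔ Palindromic (c +ℤ (s +ℤ s)) F
palindromic-shift {s = s} {c} {G} {F} F≗G = mk⇔ shift-forth shift-back
  where
  reflect-forth : ∀ c s z → c -ℤ (z -ℤ s) ≡ (c +ℤ (s +ℤ s) -ℤ z) -ℤ s
  reflect-forth = solve-∀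
  reflect-back : ∀ c s w → c +ℤ (s +ℤ s) -ℤ (w +ℤ s) ≡ (c -ℤ w) +ℤ s
  reflect-back = solve-∀
  unshift : ∀ s w → (w +ℤ s) -ℤ s ≡ w
  unshift = solve-∀

  G≗F : ∀ w → G w ≡ F (w +ℤ s)
  G≗F w = trans (cong G (sym (unshift s w))) (sym (F≗G (w +ℤ s)))

  shift-forth : Palindromic c G → Palindromic (c +ℤ (s +ℤ s)) F
  shift-forth G-pal z = begin
    F z                              ≡⟨ F≗G z ⟩
    G (z -ℤ s)                       ≡⟨ G-pal (z -ℤ s) ⟩
    G (c -ℤ (z -ℤ s))                ≡⟨ cong G (reflect-forth c s z) ⟩
    G ((c +ℤ (s +ℤ s) -ℤ z) -ℤ s)    ≡⟨ F≗G _ ⟨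
    F (c +ℤ (s +ℤ s) -ℤ z)           ∎

  shift-back : Palindromic (c +ℤ (s +ℤ s)) F → Palindromic c G
  shift-back F-pal w = begin
    G w                              ≡⟨ G≗F w ⟩
    F (w +ℤ s)                       ≡⟨ F-pal (w +ℤ s) ⟩
    F (c +ℤ (s +ℤ s) -ℤ (w +ℤ s))    ≡⟨ cong F (reflect-back c s w) ⟩
    F ((c -ℤ w) +ℤ s)                ≡⟨ G≗F (c -ℤ w) ⟨
    G (c -ℤ w)                       ∎

module _ (p : ℕ) .{{_ : NonZero p}} where
  open CommutativeRing (𝔽-commutativeRing p)
    using ( +-assoc; +-comm; +-identityˡ; +-identityʳ; -‿inverseʳ; *-assoc; *-identityˡ; *-identityʳ
          ; zeroˡ; zeroʳ; distribˡ; distribʳ; ring; +-group; +-commutativeSemigroup)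
    renaming (_+_ to _+F_; _*_ to _*F_; -_ to -F_; _-_ to _-F_; 0# to 0F; 1# to 1F)
  open RingProperties ring using (-1*x≈-x; [y-z]x≈yx-zx)
  open GroupProperties +-group
    using (x∙y⁻¹≈ε⇒x≈y; x≈y⇒x∙y⁻¹≈ε; ∙-cancelˡ; //-rightDividesˡ)
  open CommutativeSemigroupProperties +-commutativeSemigroup using (interchange; xy∙z≈xz∙y)

  infixl 7 _⊛_
  _⊛_ : Coeffs p → Coeffs p → Coeffs p
  _⊛_ = _*P_ p

  sumTo-cong : ∀ {f g : ℕ → 𝔽 p} n → (∀ j → j ≤ n → f j ≡ g j) →
               sumTo p f n ≡ sumTo p g n
  sumTo-cong zero    f≗g = f≗g 0 z≤n
  sumTo-cong (suc n) f≗g =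
    cong₂ _+F_ (sumTo-cong n (λ j j≤n → f≗g j (ℕ.m≤n⇒m≤1+n j≤n))) (f≗g (suc n) ℕ.≤-refl)

  sumTo-zero : ∀ {f : ℕ → 𝔽 p} n → (∀ j → j ≤ n → f j ≡ 0F) → sumTo p f n ≡ 0F
  sumTo-zero zero    f≗0 = f≗0 0 z≤n
  sumTo-zero (suc n) f≗0 =
    trans (cong₂ _+F_ (sumTo-zero n (λ j j≤n → f≗0 j (ℕ.m≤n⇒m≤1+n j≤n))) (f≗0 (suc n) ℕ.≤-refl))
          (+-identityʳ 0F)

  sumTo-single : ∀ {f : ℕ → 𝔽 p} n i → i ≤ n → (∀ j → j ≤ n → j ≢ i → f j ≡ 0F) →
                 sumTo p f n ≡ f i
  sumTo-single zero zero z≤n others = refl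
  sumTo-single {f} (suc n) i i≤1+n others with i ≟ suc n
  ... | yes refl =
    trans (cong (_+F f (suc n)) (sumTo-zero n λ j j≤n → others j (ℕ.m≤n⇒m≤1+n j≤n) (ℕ.<⇒≢ (s≤s j≤n))))
          (+-identityˡ (f (suc n)))
  ... | no i≢1+n =
    trans (cong₂ _+F_ (sumTo-single n i (ℕ.≤-pred (ℕ.≤∧≢⇒< i≤1+n i≢1+n))
                                        (λ j j≤n → others j (ℕ.m≤n⇒m≤1+n j≤n)))
                      (others (suc n) ℕ.≤-refl (i≢1+n ∘ sym)))
          (+-identityʳ (f i))

  sumTo-+ : ∀ (f g : ℕ → 𝔽 p) n → sumTo p (λ j → f j +F g j) n ≡ sumTo p f n +F sumTo p g n
  sumTo-+ f g zero    = refl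
  sumTo-+ f g (suc n) = trans (cong (_+F (f (suc n) +F g (suc n))) (sumTo-+ f g n))
                              (interchange (sumTo p f n) (sumTo p g n) (f (suc n)) (g (suc n)))

  sumTo-*ˡ : ∀ a (f : ℕ → 𝔽 p) n → sumTo p (λ j → a *F f j) n ≡ a *F sumTo p f n
  sumTo-*ˡ a f zero    = refl
  sumTo-*ˡ a f (suc n) = trans (cong (_+F a *F f (suc n)) (sumTo-*ˡ a f n))
                               (sym (distribˡ a (sumTo p f n) (f (suc n))))

  sumTo-neg : ∀ (f : ℕ → 𝔽 p) n → sumTo p (λ j → -F f j) n ≡ -F sumTo p f n
  sumTo-neg f n = begin
    sumTo p (λ j → -F f j) n         ≡⟨ sumTo-cong n (λ j _ → sym (-1*x≈-x (f j))) ⟩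
    sumTo p (λ j → -F 1F *F f j) n   ≡⟨ sumTo-*ˡ (-F 1F) f n ⟩
    -F 1F *F sumTo p f n             ≡⟨ -1*x≈-x _ ⟩
    -F sumTo p f n                   ∎

  sumTo-suc : ∀ (f : ℕ → 𝔽 p) n → sumTo p f (suc n) ≡ f 0 +F sumTo p (f ∘ suc) n
  sumTo-suc f zero    = refl
  sumTo-suc f (suc n) = trans (cong (_+F f (suc (suc n))) (sumTo-suc f n))
                              (+-assoc (f 0) (sumTo p (f ∘ suc) n) (f (suc (suc n))))

  infixr 8 T·_
  T·_ : Coeffs p → Coeffs p
  (T· f) zero    = 0F
  (T· f) (suc n) = f n

  T^_ : ℕ → Coeffs p
  (T^ zero) zero    = 1F
  (T^ zero) (suc _) = 0F
  T^ suc j          = T· T^ j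

  ⊛-congˡ : ∀ {f g} D n → (∀ j → f j ≡ g j) → (f ⊛ D) n ≡ (g ⊛ D) n
  ⊛-congˡ D n f≗g = sumTo-cong n (λ j _ → cong (_*F D (n ∸ j)) (f≗g j))

  ⊛-zeroˡ : ∀ D n → ((λ _ → 0F) ⊛ D) n ≡ 0F
  ⊛-zeroˡ D n = sumTo-zero n (λ j _ → zeroˡ (D (n ∸ j)))

  ⊛-distribʳ-+ : ∀ f g D n → ((λ j → f j +F g j) ⊛ D) n ≡ (f ⊛ D) n +F (g ⊛ D) n
  ⊛-distribʳ-+ f g D n =
    trans (sumTo-cong n (λ j _ → distribʳ (D (n ∸ j)) (f j) (g j))) (sumTo-+ _ _ n)

  ⊛-distribʳ-- : ∀ f g D n → ((λ j → f j -F g j) ⊛ D) n ≡ (f ⊛ D) n -F (g ⊛ D) n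
  ⊛-distribʳ-- f g D n = begin
    ((λ j → f j -F g j) ⊛ D) n
      ≡⟨ sumTo-cong n (λ j _ → [y-z]x≈yx-zx (D (n ∸ j)) (f j) (g j)) ⟩
    sumTo p (λ j → f j *F D (n ∸ j) -F g j *F D (n ∸ j)) n
      ≡⟨ sumTo-+ _ _ n ⟩
    (f ⊛ D) n +F sumTo p (λ j → -F (g j *F D (n ∸ j))) n
      ≡⟨ cong ((f ⊛ D) n +F_) (sumTo-neg _ n) ⟩
    (f ⊛ D) n -F (g ⊛ D) n
      ∎

  ⊛-scaleˡ : ∀ a f D n → ((λ j → a *F f j) ⊛ D) n ≡ a *F (f ⊛ D) n
  ⊛-scaleˡ a f D n = trans (sumTo-cong n (λ j _ → *-assoc a (f j) (D (n ∸ j)))) (sumTo-*ˡ a _ n)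

  ⊛-identityˡ : ∀ D n → (T^ 0 ⊛ D) n ≡ D n
  ⊛-identityˡ D n = trans (sumTo-single n 0 z≤n others) (*-identityˡ (D n))
    where others : ∀ j → j ≤ n → j ≢ 0 → (T^ 0) j *F D (n ∸ j) ≡ 0F
          others zero    _ 0≢0 = ⊥-elim (0≢0 refl)
          others (suc j) _ _   = zeroˡ (D (n ∸ suc j))

  ⊛-T· : ∀ f D n → (T· f ⊛ D) n ≡ (T· (f ⊛ D)) n
  ⊛-T· f D zero    = zeroˡ (D 0)
  ⊛-T· f D (suc n) =
    trans (sumTo-suc _ n) (trans (cong (_+F (f ⊛ D) n) (zeroˡ (D (suc n)))) (+-identityˡ _))

  ⊛-lowest : ∀ f D n → (∀ j → j < n → f j ≡ 0F) → (f ⊛ D) n ≡ f n *F D 0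
  ⊛-lowest f D n below =
    trans (sumTo-single n n ℕ.≤-refl others) (cong (λ i → f n *F D i) (ℕ.n∸n≡0 n))
    where others : ∀ j → j ≤ n → j ≢ n → f j *F D (n ∸ j) ≡ 0F
          others j j≤n j≢n = trans (cong (_*F D (n ∸ j)) (below j (ℕ.≤∧≢⇒< j≤n j≢n))) (zeroˡ _)

  ⊛-highest : ∀ f D d n → (∀ i → d < i → D i ≡ 0F) → (∀ j → n < j → f j ≡ 0F) →
              (f ⊛ D) (n + d) ≡ f n *F D d
  ⊛-highest f D d n D-deg above =
    trans (sumTo-single (n + d) n (ℕ.m≤m+n n d) others) (cong (λ i → f n *F D i) (ℕ.m+n∸m≡n n d))
    where others : ∀ j → j ≤ n + d → j ≢ n → f j *F D (n + d ∸ j) ≡ 0F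
          others j _ j≢n with ℕ.<-cmp j n
          ... | tri< j<n _ _ = trans (cong (f j *F_) (D-deg _ d<n+d∸j)) (zeroʳ (f j))
            where d<n+d∸j : d < n + d ∸ j
                  d<n+d∸j =
                    subst (_< n + d ∸ j) (ℕ.m+n∸m≡n n d) (ℕ.∸-monoʳ-< j<n (ℕ.m≤m+n n d))
          ... | tri≈ _ j≡n _ = ⊥-elim (j≢n j≡n)
          ... | tri> _ _ n<j = trans (cong (_*F D (n + d ∸ j)) (above j n<j)) (zeroˡ _)

  ⊛-vanishing-below : ∀ {f} D → D 0 ≡ 1F →
                      ∀ N → (∀ i → i < N → (f ⊛ D) i ≡ 0F) → ∀ i → i < N → f i ≡ 0F
  ⊛-vanishing-below D D₀ zero _ i ()
  ⊛-vanishing-below {f} D D₀ (suc N) f⊛D≡0 =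
    extend (⊛-vanishing-below {f} D D₀ N (λ i i<N → f⊛D≡0 i (ℕ.m<n⇒m<1+n i<N)))
    where
    extend : (∀ i → i < N → f i ≡ 0F) → ∀ i → i < suc N → f i ≡ 0F
    extend below-N i i<1+N with ℕ.m<1+n⇒m<n∨m≡n i<1+N
    ... | inj₁ i<N  = below-N i i<N
    ... | inj₂ refl = begin
      f N          ≡⟨ *-identityʳ (f N) ⟨
      f N *F 1F    ≡⟨ cong (f N *F_) D₀ ⟨
      f N *F D 0   ≡⟨ ⊛-lowest f D N below-N ⟨
      (f ⊛ D) N    ≡⟨ f⊛D≡0 N ℕ.≤-refl ⟩
      0F           ∎

  ⊛-vanishing-above : ∀ {f} D d → (∀ i → d < i → D i ≡ 0F) → D d ≡ 1F → IsPoly p f →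
                      ∀ N → (∀ i → N ≤ i → (f ⊛ D) (i + d) ≡ 0F) → ∀ i → N ≤ i → f i ≡ 0F
  ⊛-vanishing-above {f} D d D-deg D-top (b , f-deg) N f⊛D≡0 i = vanish b i (ℕ.m≤m+n b i)
    where
    -- Downward induction on i, with t bounding the distance from i to the degree bound b of f.
    vanish : ∀ t i → b ≤ t + i → N ≤ i → f i ≡ 0F
    vanishes-beyond : ∀ t i → b ≤ t + i → N ≤ i → ∀ j → i < j → f j ≡ 0F

    vanish t i b≤t+i N≤i = begin
      f i               ≡⟨ *-identityʳ (f i) ⟨
      f i *F 1F         ≡⟨ cong (f i *F_) D-top ⟨
      f i *F D d        ≡⟨ ⊛-highest f D d i D-deg (vanishes-beyond t i b≤t+i N≤i) ⟨
      (f ⊛ D) (i + d)   ≡⟨ f⊛D≡0 i N≤i ⟩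
      0F                ∎

    vanishes-beyond zero    i b≤i     _   j i<j = f-deg j (ℕ.≤-<-trans b≤i i<j)
    vanishes-beyond (suc t) i b≤1+t+i N≤i j i<j =
      vanish t j (ℕ.≤-trans b≤1+t+i (subst (_≤ t + j) (ℕ.+-suc t i) (ℕ.+-monoʳ-≤ t i<j)))
                 (ℕ.≤-trans N≤i (ℕ.<⇒≤ i<j))

  IsPoly-0 : IsPoly p (λ _ → 0F)
  IsPoly-0 = 0 , λ _ _ → refl

  IsPoly-zipWith : ∀ {f g} (_∙_ : 𝔽 p → 𝔽 p → 𝔽 p) → 0F ∙ 0F ≡ 0F →
                   IsPoly p f → IsPoly p g → IsPoly p (λ j → f j ∙ g j)
  IsPoly-zipWith _∙_ 0∙0≡0 (b , f-deg) (c , g-deg) = b ⊔ c , λ j b⊔c<j →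
    trans (cong₂ _∙_ (f-deg j (ℕ.≤-<-trans (ℕ.m≤m⊔n b c) b⊔c<j))
                     (g-deg j (ℕ.≤-<-trans (ℕ.m≤n⊔m b c) b⊔c<j)))
          0∙0≡0

  IsPoly-T· : ∀ {f} → IsPoly p f → IsPoly p (T· f)
  IsPoly-T· (b , f-deg) = suc b , λ { (suc j) (s≤s b<j) → f-deg j b<j }

  IsPoly-T^ : ∀ j → IsPoly p (T^ j)
  IsPoly-T^ zero    = 0 , λ { (suc _) _ → refl }
  IsPoly-T^ (suc j) = IsPoly-T· (IsPoly-T^ j)

  InRsh-cong : ∀ ℓ {f g} → (∀ n → f n ≡ g n) → InRsh p ℓ f → InRsh p ℓ g
  InRsh-cong ℓ f≗g (f-deg , f-sym) =
    (λ i 2ℓ<i → trans (sym (f≗g i)) (f-deg i 2ℓ<i)) ,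
    (λ i i≤2ℓ → trans (sym (f≗g i)) (trans (f-sym i i≤2ℓ) (f≗g (2 * ℓ ∸ i))))

  InRsh-zipWith : ∀ ℓ {f g} (_∙_ : 𝔽 p → 𝔽 p → 𝔽 p) → 0F ∙ 0F ≡ 0F →
                  InRsh p ℓ f → InRsh p ℓ g → InRsh p ℓ (λ n → f n ∙ g n)
  InRsh-zipWith _ _∙_ 0∙0≡0 (f-deg , f-sym) (g-deg , g-sym) =
    (λ i 2ℓ<i → trans (cong₂ _∙_ (f-deg i 2ℓ<i) (g-deg i 2ℓ<i)) 0∙0≡0) ,
    (λ i i≤2ℓ → cong₂ _∙_ (f-sym i i≤2ℓ) (g-sym i i≤2ℓ))

  coeffℤ : Coeffs p → ℤ → 𝔽 p
  coeffℤ f (+ n)    = f n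
  coeffℤ f -[1+ _ ] = 0F

  coeffℤ-cong : ∀ {f g} → (∀ n → f n ≡ g n) → ∀ z → coeffℤ f z ≡ coeffℤ g z
  coeffℤ-cong f≗g (+ n)    = f≗g n
  coeffℤ-cong f≗g -[1+ _ ] = refl

  coeffℤ-+ : ∀ f g z → coeffℤ (λ n → f n +F g n) z ≡ coeffℤ f z +F coeffℤ g z
  coeffℤ-+ f g (+ n)    = refl
  coeffℤ-+ f g -[1+ _ ] = sym (+-identityʳ 0F)

  coeffℤ-∸ : ∀ f {m n} → n ≤ m → coeffℤ f (+ m -ℤ + n) ≡ f (m ∸ n)
  coeffℤ-∸ f {m} {n} n≤m = cong (coeffℤ f) (trans (ℤ.m-n≡m⊖n m n) (ℤ.⊖-≥ n≤m))

  coeffℤ-< : ∀ f {m n} → m < n → coeffℤ f (+ m -ℤ + n) ≡ 0F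
  coeffℤ-< f {m} {suc n} (s≤s m≤n) = cong (coeffℤ f) (begin
    + m -ℤ + suc n           ≡⟨ ℤ.m-n≡m⊖n m (suc n) ⟩
    m ⊖ suc n                ≡⟨ ℤ.⊖-< (s≤s m≤n) ⟩
    negate (+ (suc n ∸ m))   ≡⟨ cong (negate ∘ +_) (ℕ.+-∸-assoc 1 m≤n) ⟩
    -[1+ n ∸ m ]             ∎)

  InRsh⇔palindromic : ∀ ℓ {f} → InRsh p ℓ f ⇔ Palindromic (+ (2 * ℓ)) (coeffℤ f)
  InRsh⇔palindromic ℓ {f} = mk⇔ palindromic unpalindromic
    where
    palindromic : InRsh p ℓ f → Palindromic (+ (2 * ℓ)) (coeffℤ f)
    palindromic (f-deg , _) -[1+ q ] = sym (f-deg (2 * ℓ + suc q) (ℕ.m<m+n (2 * ℓ) (s≤s z≤n)))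
    palindromic (f-deg , f-sym) (+ n) with n ≤? 2 * ℓ
    ... | yes n≤2ℓ = trans (f-sym n n≤2ℓ) (sym (coeffℤ-∸ f n≤2ℓ))
    ... | no  n≰2ℓ = trans (f-deg n (ℕ.≰⇒> n≰2ℓ)) (sym (coeffℤ-< f (ℕ.≰⇒> n≰2ℓ)))

    unpalindromic : Palindromic (+ (2 * ℓ)) (coeffℤ f) → InRsh p ℓ f
    unpalindromic f-pal = (λ n 2ℓ<n → trans (f-pal (+ n)) (coeffℤ-< f 2ℓ<n)) ,
                          (λ n n≤2ℓ → trans (f-pal (+ n)) (coeffℤ-∸ f n≤2ℓ))

  T·-isShift : ∀ f → IsShift (+ 1) (coeffℤ f) (coeffℤ (T· f))
  T·-isShift f (+ zero)  = refl
  T·-isShift f (+ suc n) = refl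
  T·-isShift f -[1+ q ]  = refl

  InRsh-T·⇔ : ∀ ℓ {f} → InRsh p ℓ f ⇔ InRsh p (suc ℓ) (T· f)
  InRsh-T·⇔ ℓ {f} = mk⇔
    (λ f∈ → from (InRsh⇔palindromic (suc ℓ))
              (subst (λ c → Palindromic c (coeffℤ (T· f))) center (to shift (to (InRsh⇔palindromic ℓ) f∈))))
    (λ T·f∈ → from (InRsh⇔palindromic ℓ)
              (from shift (subst (λ c → Palindromic c (coeffℤ (T· f))) (sym center)
                                 (to (InRsh⇔palindromic (suc ℓ)) T·f∈))))
    where
    shift : Palindromic (+ (2 * ℓ)) (coeffℤ f) ⇔
            Palindromic (+ (2 * ℓ) +ℤ (+ 1 +ℤ + 1)) (coeffℤ (T· f))
    shift = palindromic-shift {c = + (2 * ℓ)} (T·-isShift f)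
    center : + (2 * ℓ) +ℤ (+ 1 +ℤ + 1) ≡ + (2 * suc ℓ)
    center = cong +_ (trans (ℕ.+-comm (2 * ℓ) 2) (sym (ℕ.*-suc 2 ℓ)))

  ⊛-T^ : ∀ j D → IsShift (+ j) (coeffℤ D) (coeffℤ (T^ j ⊛ D))
  ⊛-T^ zero    D z = trans (coeffℤ-cong (⊛-identityˡ D) z) (cong (coeffℤ D) (sym (ℤ.+-identityʳ z)))
  ⊛-T^ (suc j) D z = begin
    coeffℤ (T· T^ j ⊛ D) z           ≡⟨ coeffℤ-cong (⊛-T· (T^ j) D) z ⟩
    coeffℤ (T· (T^ j ⊛ D)) z         ≡⟨ T·-isShift (T^ j ⊛ D) z ⟩
    coeffℤ (T^ j ⊛ D) (z -ℤ + 1)     ≡⟨ ⊛-T^ j D (z -ℤ + 1) ⟩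
    coeffℤ D (z -ℤ + 1 -ℤ + j)       ≡⟨ cong (coeffℤ D) (shifts z (+ j)) ⟩
    coeffℤ D (z -ℤ + suc j)          ∎
    where shifts : ∀ z j → z -ℤ + 1 -ℤ j ≡ z -ℤ (+ 1 +ℤ j)
          shifts = solve-∀

  palindromic-+shift : ∀ {c s G F} → Palindromic c G → (∀ z → F z ≡ G z +F G (z -ℤ s)) →
                       Palindromic (c +ℤ s) F
  palindromic-+shift {c} {s} {G} {F} G-pal F≗ z = begin
    F z                                          ≡⟨ F≗ z ⟩
    G z +F G (z -ℤ s)                            ≡⟨ +-comm (G z) (G (z -ℤ s)) ⟩
    G (z -ℤ s) +F G z                            ≡⟨ cong₂ _+F_
                                                      (reflect (z -ℤ s) (c +ℤ s -ℤ z) (identity₁ c s z))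
                                                      (reflect z (c +ℤ s -ℤ z -ℤ s) (identity₂ c s z)) ⟩
    G (c +ℤ s -ℤ z) +F G (c +ℤ s -ℤ z -ℤ s)      ≡⟨ F≗ (c +ℤ s -ℤ z) ⟨
    F (c +ℤ s -ℤ z)                              ∎
    where
    reflect : ∀ w v → w ≡ c -ℤ v → G w ≡ G v
    reflect w v w≡c-v = trans (cong G w≡c-v) (sym (G-pal v))
    identity₁ : ∀ c s z → z -ℤ s ≡ c -ℤ (c +ℤ s -ℤ z)
    identity₁ = solve-∀
    identity₂ : ∀ c s z → z ≡ c -ℤ (c +ℤ s -ℤ z -ℤ s)
    identity₂ = solve-∀

  shiftCoeff-coeffℤ : ∀ s F z → shiftCoeff p s F z ≡ coeffℤ F (z -ℤ s)
  shiftCoeff-coeffℤ s F z with z -ℤ s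
  ... | + _      = refl
  ... | -[1+ _ ] = refl

  InShiftRsh⇔isShift : ∀ {s ℓ R} → InShiftRsh p s ℓ R ⇔
                       Σ (Coeffs p) λ F → InRsh p ℓ F × IsShift s (coeffℤ F) (coeffℤ R)
  InShiftRsh⇔isShift {s} = mk⇔
    (λ (F , F∈ , F-below , R≗) → F , F∈ , λ
      { (+ n)     → trans (R≗ n) (shiftCoeff-coeffℤ s F (+ n))
      ; -[1+ n ]  → sym (trans (sym (shiftCoeff-coeffℤ s F -[1+ n ])) (F-below n)) })
    (λ (F , F∈ , R≗) → F , F∈ ,
      (λ n → trans (shiftCoeff-coeffℤ s F -[1+ n ]) (sym (R≗ -[1+ n ]))) ,
      (λ n → trans (R≗ (+ n)) (sym (shiftCoeff-coeffℤ s F (+ n)))))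

  Remainder : ℕ → ℕ → Coeffs p → Set
  Remainder k m R = InRsh p m R × (∀ n → n + k ≤ m → R n ≡ 0F)

  Remainder-vanishes-above : ∀ {k m R} → Remainder k m R → ∀ n → m + k ≤ n → R n ≡ 0F
  Remainder-vanishes-above {k} {m} ((R-deg , R-sym) , R-low) n m+k≤n with 2 * m <? n
  ... | yes 2m<n = R-deg n 2m<n
  ... | no  2m≮n = trans (R-sym n n≤2m) (R-low (2 * m ∸ n) (ℕ.+-cancelˡ-≤ m _ _ m+[2m∸n+k]≤m+m))
    where
    n≤2m : n ≤ 2 * m
    n≤2m = ℕ.≮⇒≥ 2m≮n

    rearrange : ∀ m x k → m + (x + k) ≡ x + (m + k)
    rearrange = ℕ-Solver.solve-∀

    m+[2m∸n+k]≤m+m : m + (2 * m ∸ n + k) ≤ m + m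
    m+[2m∸n+k]≤m+m =
      ℕ.≤-trans (ℕ.≤-reflexive (rearrange m (2 * m ∸ n) k))
     (ℕ.≤-trans (ℕ.+-monoʳ-≤ (2 * m ∸ n) m+k≤n)
                (ℕ.≤-reflexive (trans (ℕ.m∸n+n≡m n≤2m) (cong (λ x → m + x) (ℕ.+-identityʳ m)))))

  InShiftRsh⇔Remainder : ∀ K m {R} →
                         InShiftRsh p (remainderShift m (suc K)) K R ⇔ Remainder (suc K) m R
  InShiftRsh⇔Remainder K m {R} = mk⇔
    (λ R∈ → let (F , F∈ , R≗T^sF) = to (InShiftRsh⇔isShift {ℓ = K}) R∈ in remainder F F∈ R≗T^sF)
    (λ R-rem → from (InShiftRsh⇔isShift {ℓ = K}) (quotient-by-T^s R-rem))
    where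
    s : ℤ
    s = remainderShift m (suc K)

    -- + suc K and -[1+ q ] appear below as + 1 +ℤ + K and negate (+ 1 +ℤ + q), to which they
    -- reduce, so that the ring solver can treat them as ring expressions.
    center-identity : ∀ m K →
                      + 2 *ℤ K +ℤ ((m -ℤ (+ 1 +ℤ K) +ℤ + 1) +ℤ (m -ℤ (+ 1 +ℤ K) +ℤ + 1)) ≡ + 2 *ℤ m
    center-identity = solve-∀

    low-identity : ∀ n m K → n -ℤ (m -ℤ (+ 1 +ℤ K) +ℤ + 1) ≡ n +ℤ (+ 1 +ℤ K) -ℤ (+ 1 +ℤ m)
    low-identity = solve-∀

    below-identity : ∀ q m K →
                     negate (+ 1 +ℤ q) +ℤ (m -ℤ (+ 1 +ℤ K) +ℤ + 1) ≡ m -ℤ (+ 1 +ℤ q +ℤ K)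
    below-identity = solve-∀

    unshift : ∀ z s → z -ℤ s +ℤ s ≡ z
    unshift = solve-∀

    center : + (2 * K) +ℤ (s +ℤ s) ≡ + (2 * m)
    center = trans (cong (_+ℤ (s +ℤ s)) (ℤ.pos-* 2 K))
                   (trans (center-identity (+ m) (+ K)) (sym (ℤ.pos-* 2 m)))

    remainder : ∀ F → InRsh p K F → IsShift s (coeffℤ F) (coeffℤ R) → Remainder (suc K) m R
    remainder F F∈ R≗T^sF = R∈ , R-low
      where
      R∈ : InRsh p m R
      R∈ = from (InRsh⇔palindromic m) (subst (λ c → Palindromic c (coeffℤ R)) center
             (to (palindromic-shift {c = + (2 * K)} R≗T^sF) (to (InRsh⇔palindromic K) F∈)))

      R-low : ∀ n → n + suc K ≤ m → R n ≡ 0F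
      R-low n n+k≤m = begin
        R n                                  ≡⟨ R≗T^sF (+ n) ⟩
        coeffℤ F (+ n -ℤ s)                  ≡⟨ cong (coeffℤ F) (low-identity (+ n) (+ m) (+ K)) ⟩
        coeffℤ F (+ (n + suc K) -ℤ + suc m)  ≡⟨ coeffℤ-< F (s≤s n+k≤m) ⟩
        0F                                   ∎

    quotient-by-T^s : Remainder (suc K) m R →
                      Σ (Coeffs p) λ F → InRsh p K F × IsShift s (coeffℤ F) (coeffℤ R)
    quotient-by-T^s (R∈ , R-low) = F , F∈ , R≗T^sF
      where
      F : Coeffs p
      F j = coeffℤ R (+ j +ℤ s)

      R-below-s : ∀ q → coeffℤ R (-[1+ q ] +ℤ s) ≡ 0F
      R-below-s q rewrite below-identity (+ q) (+ m) (+ K) with suc q + K ≤? m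
      ... | yes 1+q+K≤m = trans (coeffℤ-∸ R 1+q+K≤m) (R-low _ (ℕ.≤-trans
                            (ℕ.+-monoʳ-≤ (m ∸ (suc q + K)) (s≤s (ℕ.m≤n+m K q)))
                            (ℕ.≤-reflexive (ℕ.m∸n+n≡m 1+q+K≤m))))
      ... | no  1+q+K≰m = coeffℤ-< R (ℕ.≰⇒> 1+q+K≰m)

      F-coeffℤ : ∀ w → coeffℤ F w ≡ coeffℤ R (w +ℤ s)
      F-coeffℤ (+ j)    = refl
      F-coeffℤ -[1+ q ] = sym (R-below-s q)

      R≗T^sF : IsShift s (coeffℤ F) (coeffℤ R)
      R≗T^sF z = sym (trans (F-coeffℤ (z -ℤ s)) (cong (coeffℤ R) (unshift z s)))

      F∈ : InRsh p K F
      F∈ = from (InRsh⇔palindromic K) (from (palindromic-shift {c = + (2 * K)} R≗T^sF)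
             (subst (λ c → Palindromic c (coeffℤ R)) (sym center) (to (InRsh⇔palindromic m) R∈)))

  module _ (K : ℕ) {D : Coeffs p} (D∈R : InR p (suc K) D) where
    private
      k : ℕ
      k = suc K

      D-deg : ∀ i → 2 * k < i → D i ≡ 0F
      D-deg = proj₁ (proj₁ D∈R)

      D₀ : D 0 ≡ 1F
      D₀ = proj₂ D∈R

      D-top : D (2 * k) ≡ 1F
      D-top = trans (proj₂ (proj₁ D∈R) (2 * k) ℕ.≤-refl) (trans (cong D (ℕ.n∸n≡0 (2 * k))) D₀)

    division-unique : ∀ {m Q R Q′ R′} →
                      IsPoly p Q → Remainder k m R → IsPoly p Q′ → Remainder k m R′ →
                      (∀ n → (Q ⊛ D) n +F R n ≡ (Q′ ⊛ D) n +F R′ n) →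
                      (∀ n → Q n ≡ Q′ n) × (∀ n → R n ≡ R′ n)
    division-unique {m} {Q} {R} {Q′} {R′} Q-poly R-rem Q′-poly R′-rem eq = Q≗Q′ , R≗R′
      where
      E : Coeffs p
      E j = Q j -F Q′ j

      E⊛D-vanishes : ∀ n → R n ≡ 0F → R′ n ≡ 0F → (E ⊛ D) n ≡ 0F
      E⊛D-vanishes n R≡0 R′≡0 = trans (⊛-distribʳ-- Q Q′ D n) (x≈y⇒x∙y⁻¹≈ε (begin
        (Q ⊛ D) n            ≡⟨ +-identityʳ _ ⟨
        (Q ⊛ D) n +F 0F      ≡⟨ cong ((Q ⊛ D) n +F_) R≡0 ⟨
        (Q ⊛ D) n +F R n     ≡⟨ eq n ⟩
        (Q′ ⊛ D) n +F R′ n   ≡⟨ cong ((Q′ ⊛ D) n +F_) R′≡0 ⟩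
        (Q′ ⊛ D) n +F 0F     ≡⟨ +-identityʳ _ ⟩
        (Q′ ⊛ D) n           ∎))

      E⊛D-low : ∀ i → i + k ≤ m → (E ⊛ D) i ≡ 0F
      E⊛D-low i i+k≤m = E⊛D-vanishes i (proj₂ R-rem i i+k≤m) (proj₂ R′-rem i i+k≤m)

      E⊛D-high : ∀ i → m + k ≤ i → (E ⊛ D) i ≡ 0F
      E⊛D-high i m+k≤i =
        E⊛D-vanishes i (Remainder-vanishes-above R-rem i m+k≤i) (Remainder-vanishes-above R′-rem i m+k≤i)

      E≡0 : ∀ n → E n ≡ 0F
      E≡0 n with n + k ≤? m
      ... | yes n+k≤m = ⊛-vanishing-below {E} D D₀ (suc n) E⊛D-below n ℕ.≤-refl
        where E⊛D-below : ∀ i → i < suc n → (E ⊛ D) i ≡ 0F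
              E⊛D-below i i≤n = E⊛D-low i (ℕ.≤-trans (ℕ.+-monoˡ-≤ k (ℕ.≤-pred i≤n)) n+k≤m)
      ... | no  n+k≰m = ⊛-vanishing-above {E} D (2 * k) D-deg D-top E-poly n E⊛D-above n ℕ.≤-refl
        where E-poly : IsPoly p E
              E-poly = IsPoly-zipWith _-F_ (-‿inverseʳ 0F) Q-poly Q′-poly
              E⊛D-above : ∀ i → n ≤ i → (E ⊛ D) (i + 2 * k) ≡ 0F
              E⊛D-above i n≤i = E⊛D-high (i + 2 * k) (ℕ.≤-trans
                (ℕ.+-monoˡ-≤ k (ℕ.≤-trans (ℕ.<⇒≤ (ℕ.≰⇒> n+k≰m)) (ℕ.+-monoˡ-≤ k n≤i)))
                (ℕ.≤-reflexive (trans (ℕ.+-assoc i k k)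
                                      (cong (λ x → i + (k + x)) (sym (ℕ.+-identityʳ k))))))

      Q≗Q′ : ∀ n → Q n ≡ Q′ n
      Q≗Q′ n = x∙y⁻¹≈ε⇒x≈y (Q n) (Q′ n) (E≡0 n)

      R≗R′ : ∀ n → R n ≡ R′ n
      R≗R′ n = ∙-cancelˡ ((Q ⊛ D) n) (R n) (R′ n)
                 (trans (eq n) (cong (_+F R′ n) (⊛-congˡ D n (sym ∘ Q≗Q′))))

    Division : ℕ → Coeffs p → Set
    Division m C = Σ (Coeffs p) λ Q → Σ (Coeffs p) λ R →
                   IsPoly p Q × Remainder k m R × (∀ n → C n ≡ (Q ⊛ D) n +F R n)

    division-T· : ∀ {m C} → Division m C → Division (suc m) (T· C)
    division-T· {m} {C} (Q , R , Q-poly , (R∈ , R-low) , eq) =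
      T· Q , T· R , IsPoly-T· Q-poly , (to (InRsh-T·⇔ m) R∈ , T·R-low) , T·-eq
      where
      T·R-low : ∀ n → n + k ≤ suc m → (T· R) n ≡ 0F
      T·R-low zero    _           = refl
      T·R-low (suc n) (s≤s n+k≤m) = R-low n n+k≤m

      T·-eq : ∀ n → (T· C) n ≡ (T· Q ⊛ D) n +F (T· R) n
      T·-eq zero    = sym (trans (cong (_+F 0F) (⊛-T· Q D 0)) (+-identityʳ 0F))
      T·-eq (suc n) = trans (eq n) (cong (_+F R n) (sym (⊛-T· Q D (suc n))))

    division-+-multiple : ∀ {m C C′ A} a → IsPoly p A → (∀ n → C n ≡ C′ n +F a *F (A ⊛ D) n) →
                          Division m C′ → Division m C
    division-+-multiple {C = C} {C′} {A} a A-poly C≡ (Q , R , Q-poly , R-rem , eq) =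
      Q′ , R , Q′-poly , R-rem , eq′
      where
      Q′ : Coeffs p
      Q′ j = Q j +F a *F A j

      Q′-poly : IsPoly p Q′
      Q′-poly = IsPoly-zipWith (λ q x → q +F a *F x) (trans (+-identityˡ _) (zeroʳ a)) Q-poly A-poly

      Q′⊛D : ∀ n → (Q′ ⊛ D) n ≡ (Q ⊛ D) n +F a *F (A ⊛ D) n
      Q′⊛D n = trans (⊛-distribʳ-+ Q (λ j → a *F A j) D n) (cong ((Q ⊛ D) n +F_) (⊛-scaleˡ a A D n))

      eq′ : ∀ n → C n ≡ (Q′ ⊛ D) n +F R n
      eq′ n = begin
        C n                                  ≡⟨ C≡ n ⟩
        C′ n +F a *F (A ⊛ D) n               ≡⟨ cong (_+F a *F (A ⊛ D) n) (eq n) ⟩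
        (Q ⊛ D) n +F R n +F a *F (A ⊛ D) n   ≡⟨ xy∙z≈xz∙y ((Q ⊛ D) n) (R n) (a *F (A ⊛ D) n) ⟩
        (Q ⊛ D) n +F a *F (A ⊛ D) n +F R n   ≡⟨ cong (_+F R n) (Q′⊛D n) ⟨
        (Q′ ⊛ D) n +F R n                    ∎

    multiple-in-R : ∀ W → Σ (Coeffs p) λ A → IsPoly p A × InR p (W + k) (A ⊛ D)
    multiple-in-R zero =
      T^ 0 , IsPoly-T^ 0 , InRsh-cong k (sym ∘ ⊛-identityˡ D) (proj₁ D∈R) , trans (⊛-identityˡ D 0) D₀
    multiple-in-R (suc w) = A , IsPoly-zipWith _+F_ (+-identityʳ 0F) (IsPoly-T^ 0) (IsPoly-T^ t) , S∈ , S₀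
      where
      t : ℕ
      t = 2 * suc w

      A : Coeffs p
      A j = (T^ 0) j +F (T^ t) j

      S-coeffℤ : ∀ z → coeffℤ (A ⊛ D) z ≡ coeffℤ D z +F coeffℤ D (z -ℤ + t)
      S-coeffℤ z = begin
        coeffℤ (A ⊛ D) z
          ≡⟨ coeffℤ-cong (⊛-distribʳ-+ (T^ 0) (T^ t) D) z ⟩
        coeffℤ (λ n → (T^ 0 ⊛ D) n +F (T^ t ⊛ D) n) z
          ≡⟨ coeffℤ-+ (T^ 0 ⊛ D) (T^ t ⊛ D) z ⟩
        coeffℤ (T^ 0 ⊛ D) z +F coeffℤ (T^ t ⊛ D) z
          ≡⟨ cong₂ _+F_ (coeffℤ-cong (⊛-identityˡ D) z) (⊛-T^ t D z) ⟩
        coeffℤ D z +F coeffℤ D (z -ℤ + t)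
          ∎

      center : + (2 * k) +ℤ + t ≡ + (2 * (suc w + k))
      center = cong +_ (trans (ℕ.+-comm (2 * k) t) (sym (ℕ.*-distribˡ-+ 2 (suc w) k)))

      S∈ : InRsh p (suc w + k) (A ⊛ D)
      S∈ = from (InRsh⇔palindromic (suc w + k)) (subst (λ c → Palindromic c (coeffℤ (A ⊛ D))) center
             (palindromic-+shift {c = + (2 * k)} (to (InRsh⇔palindromic k) (proj₁ D∈R)) S-coeffℤ))

      S₀ : (A ⊛ D) 0 ≡ 1F
      S₀ = trans (S-coeffℤ (+ 0)) (trans (+-identityʳ (D 0)) D₀)

    division-exists : ∀ m C → InRsh p m C → Division m C
    division-exists m C C∈ with k ≤? m
    division-exists m C C∈ | no k≰m =
      (λ _ → 0F) , C , IsPoly-0 , (C∈ , λ n n+k≤m → ⊥-elim (k≰m (ℕ.≤-trans (ℕ.m≤n+m k n) n+k≤m))) ,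
      λ n → sym (trans (cong (_+F C n) (⊛-zeroˡ D n)) (+-identityˡ (C n)))
    division-exists zero    C C∈ | yes ()
    division-exists (suc m) C C∈ | yes k≤1+m =
      division-+-multiple a A-poly C≡ (division-T· (division-exists m C″ C″∈))
      where
      A : Coeffs p
      A = proj₁ (multiple-in-R (suc m ∸ k))

      A-poly : IsPoly p A
      A-poly = proj₁ (proj₂ (multiple-in-R (suc m ∸ k)))

      S : Coeffs p
      S = A ⊛ D

      S∈R : InR p (suc m) S
      S∈R = subst (λ ℓ → InR p ℓ S) (ℕ.m∸n+n≡m k≤1+m) (proj₂ (proj₂ (multiple-in-R (suc m ∸ k))))

      a : 𝔽 p
      a = C 0

      C′ : Coeffs p
      C′ n = C n -F a *F S n

      C′∈ : InRsh p (suc m) C′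
      C′∈ = InRsh-zipWith (suc m) (λ c x → c -F a *F x)
              (trans (cong (λ x → 0F -F x) (zeroʳ a)) (-‿inverseʳ 0F)) C∈ (proj₁ S∈R)

      C″ : Coeffs p
      C″ = C′ ∘ suc

      C′≗T·C″ : ∀ n → C′ n ≡ (T· C″) n
      C′≗T·C″ zero    = begin
        a -F a *F S 0   ≡⟨ cong (λ x → a -F a *F x) (proj₂ S∈R) ⟩
        a -F a *F 1F    ≡⟨ cong (λ x → a -F x) (*-identityʳ a) ⟩
        a -F a          ≡⟨ -‿inverseʳ a ⟩
        0F              ∎
      C′≗T·C″ (suc n) = refl

      C″∈ : InRsh p m C″
      C″∈ = from (InRsh-T·⇔ m) (InRsh-cong (suc m) C′≗T·C″ C′∈)

      C≡ : ∀ n → C n ≡ (T· C″) n +F a *F S n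
      C≡ n = trans (sym (//-rightDividesˡ (a *F S n) (C n))) (cong (_+F a *F S n) (C′≗T·C″ n))

lemma8p1 : (p : ℕ) .{{_ : NonZero p}} → Prime p → (k m : ℕ) → 1 ≤ k →
    (C D : Coeffs p) → InRsh p m C → InR p k D →
    (Σ (Coeffs p) λ Q → Σ (Coeffs p) λ R →
        IsPoly p Q × InShiftRsh p ((+ m -ℤ + k) +ℤ + 1) (k ∸ 1) R
        × (∀ n → C n ≡ _+P_ p (_*P_ p Q D) R n))
    × ((Q R Q′ R′ : Coeffs p) →
        IsPoly p Q → InShiftRsh p ((+ m -ℤ + k) +ℤ + 1) (k ∸ 1) R
        → (∀ n → C n ≡ _+P_ p (_*P_ p Q D) R n) →
        IsPoly p Q′ → InShiftRsh p ((+ m -ℤ + k) +ℤ + 1) (k ∸ 1) R′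
        → (∀ n → C n ≡ _+P_ p (_*P_ p Q′ D) R′ n) →
        (∀ n → Q n ≡ Q′ n) × (∀ n → R n ≡ R′ n))
    × ((R : Coeffs p) → InShiftRsh p ((+ m -ℤ + k) +ℤ + 1) (k ∸ 1) R → InRsh p m R)
lemma8p1 p _ (suc K) m (s≤s z≤n) C D C∈ D∈R =
  (let (Q , R , Q-poly , R-rem , eq) = division-exists p K D∈R m C C∈
   in Q , R , Q-poly , from (remainders R) R-rem , eq) ,
  (λ Q R Q′ R′ Q-poly R∈ eq Q′-poly R′∈ eq′ →
     division-unique p K D∈R Q-poly (to (remainders R) R∈) Q′-poly (to (remainders R′) R′∈)
                     (λ n → trans (sym (eq n)) (eq′ n))) ,
  (λ R → proj₁ ∘ to (remainders R))
  where
  remainders : ∀ R → InShiftRsh p (remainderShift m (suc K)) K R ⇔ Remainder p (suc K) m R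
  remainders R = InShiftRsh⇔Remainder p K m
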